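{- (i) The double-net is not locatable. (ii) The rooted double-net is locatable.
   Context: The double-net is the graph on 9 vertices consisting of a triangle with vertices $a,b,c$ in which each of $a,b,c$ has two pendant leaves attached. The rooted double-net is obtained from the double-net by adding a new vertex $r$ adjacent to the two leaves attached to $a$. The robber-locating game on a finite connected simple graph $G$: a robber occupies an unknown vertex. In each round the cop probes any vertex $p$ of $G$ (no restriction), and the robber truthfully announces the graph distance from his current vertex to $p$. If the information gathered so far determines the robber's current vertex uniquely, the cop wins. Otherwise the robber moves to an adjacent vertex or stays put, with the no-backtrack condition: he may not move to the vertex $p$ just probed. The robber is omniscient. $G$ is locatable if the cop has a strategy guaranteed to determine the robber's vertex after finitely many probes, and non-locatable otherwise. -}

module Defs where

open import Data.Nat using (ℕ; zero; suc; _≤_)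
open import Data.Nat as ℕ using ()
open import Data.Bool using (Bool; true; false; _∧_; _∨_; not; if_then_else_)
open import Data.Fin using (Fin; zero; suc; #_)
open import Data.Fin.Properties using (_≟_)
open import Data.Fin.Subset using (Subset; ∣_∣; ⊤)
open import Data.Vec using (Vec; tabulate; lookup)
open import Data.List using (List; []; _∷_; allFin)
open import Data.Bool.ListAction using (any)
open import Data.Product using (_×_; _,_)
open import Relation.Nullary.Decidable using (⌊_⌋)

-- Finite simple graphs on vertex set Fin n, given by a list of edges.
-- Adjacency is the symmetric closure of the edge list (no loops occur
-- in the concrete graphs used below).

record Graph (n : ℕ) : Set where
  constructor mkGraph
  field
    edges : List (Fin n × Fin n)

open Graph public

eqᵇ : ∀ {n} → Fin n → Fin n → Bool
eqᵇ u v = ⌊ u ≟ v ⌋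

adj : ∀ {n} → Graph n → Fin n → Fin n → Bool
adj G u v = any (λ { (x , y) → (eqᵇ x u ∧ eqᵇ y v) ∨ (eqᵇ x v ∧ eqᵇ y u) }) (edges G)

within : ∀ {n} → Graph n → ℕ → Fin n → Fin n → Bool
within G zero    u v = eqᵇ u v
within G (suc k) u v = within G k u v ∨ any (λ w → adj G u w ∧ within G k w v) (allFin _)

-- Graph distance: the least k with a walk of length ≤ k from u to v
-- (searching k = 0 … n; for a connected graph on n vertices the
-- distance is < n, so the search always succeeds on connected graphs).
distFrom : ∀ {n} → Graph n → ℕ → ℕ → Fin n → Fin n → ℕ
distFrom G k zero       u v = k
distFrom G k (suc fuel) u v =
  if within G k u v then k else distFrom G (suc k) fuel u v

dist : ∀ {n} → Graph n → Fin n → Fin n → ℕ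
dist {n} G u v = distFrom G 0 (suc n) u v

-- The robber-locating game.
-- The cop's knowledge is the set S ⊆ V of vertices where the robber can
-- currently be, consistent with all answers so far (initially all of V).

consistent : ∀ {n} → Graph n → Subset n → Fin n → ℕ → Subset n
consistent G S p d = tabulate λ v → lookup S v ∧ eqᵇ' (dist G v p) d
  where
  eqᵇ' : ℕ → ℕ → Bool
  eqᵇ' a b = ⌊ a ℕ.≟ b ⌋

move : ∀ {n} → Graph n → Subset n → Fin n → Subset n
move {n} G S p = tabulate λ w →
  not (eqᵇ w p) ∧ any (λ v → lookup S v ∧ (eqᵇ v w ∨ adj G v w)) (allFin n)

-- CopWins G S : from knowledge state S the cop has a strategy that
-- determines the robber's vertex after finitely many probes, against
-- every (omniscient) robber.
data CopWins {n : ℕ} (G : Graph n) : Subset n → Set where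
  probe : ∀ {S} (p : Fin n) →
          (∀ (d : ℕ) → 2 ≤ ∣ consistent G S p d ∣ →
             CopWins G (move G (consistent G S p d) p)) →
          CopWins G S

Locatable : ∀ {n} → Graph n → Set
Locatable {n} G = CopWins G ⊤

-- The double-net: triangle a=0, b=1, c=2; leaves 3,4 on a; 5,6 on b;
-- 7,8 on c.

doubleNet : Graph 9
doubleNet = mkGraph
  ( (# 0 , # 1) ∷ (# 1 , # 2) ∷ (# 0 , # 2)
  ∷ (# 0 , # 3) ∷ (# 0 , # 4)
  ∷ (# 1 , # 5) ∷ (# 1 , # 6)
  ∷ (# 2 , # 7) ∷ (# 2 , # 8) ∷ [])

-- The rooted double-net: add r = 9 adjacent to the two leaves 3,4 of a.
rootedDoubleNet : Graph 10
rootedDoubleNet = mkGraph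
  ( (# 0 , # 1) ∷ (# 1 , # 2) ∷ (# 0 , # 2)
  ∷ (# 0 , # 3) ∷ (# 0 , # 4)
  ∷ (# 1 , # 5) ∷ (# 1 , # 6)
  ∷ (# 2 , # 7) ∷ (# 2 , # 8)
  ∷ (# 9 , # 3) ∷ (# 9 , # 4) ∷ [])

module Submission where

-- A family P of knowledge states is *evasive* if from every
-- state in P, whatever vertex the cop probes, the robber has an answer
-- leaving at least two candidates and such that, after his move, the
-- cop's knowledge is again in P.  An evasive family containing the
-- initial state ⊤ shows that the cop never wins.  For the double-net
-- we take the family of states missing at most one leaf pair and one
-- further vertex; it is evasive, which is verified by a finite search
-- in which the robber answers d(p,Δ)+1 or d(p,Δ)+2 to a probe p (Δ the
-- triangle).
--
-- A cop strategy is a finite tree: a probe together with a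
-- continuation for every answer.  It wins from a knowledge state if
-- every possible answer either locates the robber or leads, after his
-- move, to a state won by the continuation.  Since distances are at most
-- n+1, only finitely many answers matter, so winning is decidable and
-- implies CopWins.  An explicit strategy for the rooted double-net is
-- then checked by evaluation.

open import Defs
open import Data.Product using (_×_)
open import Relation.Nullary using (¬_)

open import Function using (_∘_)
open import Data.Bool using (Bool; true; false; _∧_; if_then_else_)
open import Data.Bool.Properties using (∧-zeroʳ)
open import Data.Empty using (⊥)
open import Data.Fin using (Fin; zero; suc; toℕ; fromℕ<; #_)
open import Data.Fin.Properties using (all?; toℕ-fromℕ<)
open import Data.Fin.Subset using (Subset; ∣_∣; ∁; _∪_; ⁅_⁆; ⊤)
open import Data.Fin.Subset.Properties using (anySubset?)
open import Data.List using (List; []; _∷_)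
open import Data.List.Relation.Unary.Any using (Any; here; satisfied)
import Data.List.Relation.Unary.Any as Any
open import Data.Nat using (ℕ; suc; _+_; _≤_; _<_; _≤?_; _<?_; _<ᵇ_; z≤n)
import Data.Nat as ℕ
open import Data.Nat.Properties using (m≤m+n; +-suc; <⇒≢; <⇒≱; ≤-<-trans; ≮⇒≥)
open import Data.Product using (∃; _,_)
open import Data.Sum using (_⊎_; inj₁; inj₂)
open import Data.Vec using (tabulate; lookup)
open import Relation.Binary.PropositionalEquality using (_≡_; refl; sym; subst)
open import Relation.Nullary using (Dec; yes; no; ¬?; contradiction)
open import Relation.Nullary.Decidable using (⌊_⌋; _×-dec_; _⊎-dec_; from-yes; from-no; decidable-stable)
open import Relation.Unary using (Decidable)

∣tabulate∣-false : ∀ {m} (f : Fin m → Bool) → (∀ v → f v ≡ false) → ∣ tabulate f ∣ ≡ 0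
∣tabulate∣-false {ℕ.zero} f none = refl
∣tabulate∣-false {suc m}  f none rewrite none zero = ∣tabulate∣-false (f ∘ suc) (none ∘ suc)

module DistanceBounds {n : ℕ} (G : Graph n) where

  distFrom-bound : ∀ k fuel u v → distFrom G k fuel u v ≤ k + fuel
  distFrom-bound k ℕ.zero u v = m≤m+n k 0
  distFrom-bound k (suc fuel) u v with within G k u v
  ... | true  = m≤m+n k (suc fuel)
  ... | false = subst (distFrom G (suc k) fuel u v ≤_) (sym (+-suc k fuel)) (distFrom-bound (suc k) fuel u v)

  dist-bound : ∀ u v → dist G u v ≤ suc n
  dist-bound = distFrom-bound 0 (suc n)

  farAnswer : ∀ S p {d} → suc n < d → ∣ consistent G S p d ∣ ≡ 0
  farAnswer S p {d} far = ∣tabulate∣-false _ unreachable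
    where
    unreachable : ∀ v → lookup S v ∧ ⌊ dist G v p ℕ.≟ d ⌋ ≡ false
    unreachable v with dist G v p ℕ.≟ d
    ... | yes reached = contradiction reached (<⇒≢ (≤-<-trans (dist-bound v p) far))
    ... | no _        = ∧-zeroʳ (lookup S v)

module Evasion {n : ℕ} (G : Graph n) (P : Subset n → Set) where

  Hidden : Subset n → Fin n → Set
  Hidden C p = 2 ≤ ∣ C ∣ × P (move G C p)

  Evasive : Set
  Evasive = ∀ S → P S → ∀ p → ∃ λ d → Hidden (consistent G S p d) p

  -- From a state of an evasive family the cop cannot force a win:
  -- follow her winning strategy, always giving the hiding answer.
  evasive⇒¬CopWins : Evasive → ∀ {S} → P S → ¬ CopWins G S
  evasive⇒¬CopWins evasive {S} PS (probe p win) with evasive S PS p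
  ... | d , two , PS′ = evasive⇒¬CopWins evasive PS′ (win d two)

  -- Evasiveness certified by a finite search: for each probe p the robber
  -- tries the answers in  menu p.
  module Search (P? : Decidable P) (menu : Fin n → List ℕ) where

    hidden? : ∀ C p → Dec (Hidden C p)
    hidden? C p = (2 ≤? ∣ C ∣) ×-dec P? (move G C p)

    Escapes : Subset n → Set
    Escapes S = ∀ p → Any (λ d → Hidden (consistent G S p d) p) (menu p)

    escapes? : Decidable Escapes
    escapes? S = all? λ p → Any.any? (λ d → hidden? (consistent G S p d) p) (menu p)

    Counterexample : Subset n → Set
    Counterexample S = P S × ¬ Escapes S

    counterexample? : Decidable Counterexample
    counterexample? S = P? S ×-dec ¬? (escapes? S)

    noCounterexample⇒evasive : ¬ ∃ Counterexample → Evasive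
    noCounterexample⇒evasive none S PS p =
      satisfied (decidable-stable (escapes? S) (λ ¬esc → none (S , PS , ¬esc)) p)

-- The cop's side: finite strategy trees.  query p next  probes p and
-- continues with  next d  after answer d;  stop  probes no more, so it is
-- only used where the previous answer has already located the robber.
data Strategy (n : ℕ) : Set where
  stop  : Strategy n
  query : Fin n → (ℕ → Strategy n) → Strategy n

module Strategies {n : ℕ} (G : Graph n) where
  open DistanceBounds G

  mutual
    Wins : Strategy n → Subset n → Set
    Wins stop          S = ⊥
    Wins (query p next) S =
      (d : Fin (2 + n)) → Settled (next (toℕ d)) (consistent G S p (toℕ d)) p

    Settled : Strategy n → Subset n → Fin n → Set
    Settled t C p = ∣ C ∣ ≤ 1 ⊎ Wins t (move G C p)

  mutual
    wins? : ∀ t S → Dec (Wins t S)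
    wins? stop           S = no λ ()
    wins? (query p next) S = all? λ d → settled? (next (toℕ d)) (consistent G S p (toℕ d)) p

    settled? : ∀ t C p → Dec (Settled t C p)
    settled? t C p = (∣ C ∣ ≤? 1) ⊎-dec wins? t (move G C p)

  settledAt : ∀ {p next S} → Wins (query p next) S →
              ∀ {d} → d < 2 + n → Settled (next d) (consistent G S p d) p
  settledAt {p} {next} {S} w d< =
    subst (λ e → Settled (next e) (consistent G S p e) p) (toℕ-fromℕ< d<) (w (fromℕ< d<))

  wins⇒CopWins : ∀ t {S} → Wins t S → CopWins G S
  wins⇒CopWins stop           ()
  wins⇒CopWins (query p next) {S} w = probe p answer
    where
    answer : ∀ d → 2 ≤ ∣ consistent G S p d ∣ → CopWins G (move G (consistent G S p d) p)
    answer d two with d <? 2 + n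
    ... | no d≮ = contradiction (subst (2 ≤_) (farAnswer S p (≮⇒≥ d≮)) two) λ ()
    ... | yes d< with settledAt {p} {next} {S} w d<
    ...   | inj₁ located = contradiction located (<⇒≱ two)
    ...   | inj₂ won     = wins⇒CopWins (next d) won

leafPairs : List (Subset 9)
leafPairs = (⁅ # 3 ⁆ ∪ ⁅ # 4 ⁆) ∷ (⁅ # 5 ⁆ ∪ ⁅ # 6 ⁆) ∷ (⁅ # 7 ⁆ ∪ ⁅ # 8 ⁆) ∷ []

-- The robber's invariant on the double-net: the cop has ruled out at most
-- one leaf pair and one further vertex.
Large : Subset 9 → Set
Large S = Any (λ L → ∣ ∁ (S ∪ L) ∣ ≤ 1) leafPairs

large? : Decidable Large
large? S = Any.any? (λ L → ∣ ∁ (S ∪ L) ∣ ≤? 1) leafPairs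

-- The robber's candidate answers to a probe p: d(p,Δ)+1 and d(p,Δ)+2,
-- where Δ = {0,1,2} is the triangle.
menu : Fin 9 → List ℕ
menu p = if toℕ p <ᵇ 3 then 1 ∷ 2 ∷ [] else 2 ∷ 3 ∷ []

module DoubleNet where
  open Evasion doubleNet Large
  open Search large? menu

  -- Exhaustive search over all 2⁹ knowledge states.
  large-evasive : Evasive
  large-evasive = noCounterexample⇒evasive (from-no (anySubset? counterexample?))

  notLocatable : ¬ Locatable doubleNet
  notLocatable = evasive⇒¬CopWins large-evasive (here z≤n)

-- A winning strategy on the rooted double-net: probe b, after answer 1 also
-- c, then the root r, and finally one leaf: a leaf of a if r answered 1,
-- otherwise a leaf of the branch (b or c) that is still possible.
rootedStrategy : Strategy 10
rootedStrategy = query (# 1) λ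
  { 1 → query (# 2) λ { 1 → viaRoot (# 7) ; 2 → viaRoot (# 5) ; _ → stop }
  ; 2 → viaRoot (# 7)
  ; _ → stop
  }
  where
  viaRoot : Fin 10 → Strategy 10
  viaRoot x = query (# 9) λ { 1 → query (# 3) (λ _ → stop) ; 4 → query x (λ _ → stop) ; _ → stop }

module RootedDoubleNet where
  open Strategies rootedDoubleNet

  locatable : Locatable rootedDoubleNet
  locatable = wins⇒CopWins rootedStrategy (from-yes (wins? rootedStrategy ⊤))

lemma2p2 : ¬ Locatable doubleNet × Locatable rootedDoubleNet
lemma2p2 = DoubleNet.notLocatable , RootedDoubleNet.locatable
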